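{- Let $\mathcal{L}=(L,\leq)$ be a finite congruence-uniform lattice. Then $\mathrm{bdef}(\mathcal{L})=0$ if and only if for every $x\in L$ the interval $[x_{\downarrow},x]$ is isomorphic to a Boolean lattice.
   Context: For a finite lattice $\mathcal{L}=(L,\leq)$, $\mathcal{J}(\mathcal{L})$ denotes the set of join-irreducible elements; each $j\in\mathcal{J}(\mathcal{L})$ has a unique lower cover $j_*$. For a cover relation $u\lessdot v$, $\mathrm{cg}(u,v)$ is the finest lattice congruence in which $u,v$ are equivalent, and $\mathrm{cg}(j)=\mathrm{cg}(j_*,j)$; the join-irreducible elements of the congruence lattice are exactly the $\mathrm{cg}(j)$. A finite lattice is congruence-uniform if $j\mapsto\mathrm{cg}(j)$ is a bijection from $\mathcal{J}(\mathcal{L})$ onto the join-irreducible congruences, for both $\mathcal{L}$ and its dual. For a cover $u\lessdot v$, $j_{\mathrm{cg}(u,v)}$ denotes the unique $j\in\mathcal{J}(\mathcal{L})$ with $\mathrm{cg}(j)=\mathrm{cg}(u,v)$. The nucleus of $x$ is $x_\downarrow=\bigwedge\{y\mid y\lessdot x\}$ (take $x_\downarrow=\hat0$ for $x=\hat0$); the core label set is $\Psi(x)=\{j_{\mathrm{cg}(u,v)}\mid x_\downarrow\le u\lessdot v\le x\}$. $\Gamma(x)$ is the canonical join representation of $x$ (the irredundant join representation of $x$ refining all others; it exists in congruence-uniform lattices). The Boolean defect is $\mathrm{bdef}(\mathcal{L})=\sum_{x\in L}|\Psi(x)\setminus\Gamma(x)|$. -}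

module Defs where

open import Data.Bool using (Bool; T)
open import Data.Nat using (ℕ; suc)
open import Data.Fin using (Fin; zero; _≟_)
open import Data.Fin.Properties using (all?)
open import Data.Fin.Subset using (Subset; _∈_; _⊆_; _⊂_)
open import Data.Fin.Subset.Properties using (_∈?_)
open import Data.List using (List; foldr; filter; length; map; allFin)
open import Data.Nat.ListAction using (sum)
open import Data.List.Relation.Unary.Unique.Propositional using (Unique)
import Data.List.Membership.Propositional as LM
open import Data.Product using (Σ; ∃; ∃-syntax; _×_; _,_; swap)
open import Data.Sum using (_⊎_)
open import Relation.Binary.PropositionalEquality using (_≡_; _≢_; cong₂)
import Relation.Binary.PropositionalEquality as Eq
open import Relation.Nullary using (Dec; ¬_)
open import Relation.Nullary.Decidable using (_×-dec_; _⊎-dec_; _→-dec_; ¬?)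
open import Algebra.Lattice.Structures using (IsLattice)
open import Function.Bundles using (_⇔_)

record FinLattice : Set where
  field
    n         : ℕ
    _∨_       : Fin (suc n) → Fin (suc n) → Fin (suc n)
    _∧_       : Fin (suc n) → Fin (suc n) → Fin (suc n)
    isLattice : IsLattice {A = Fin (suc n)} _≡_ _∨_ _∧_

dual : FinLattice → FinLattice
dual L = record
  { n = n ; _∨_ = _∧_ ; _∧_ = _∨_
  ; isLattice = record
    { isEquivalence = Eq.isEquivalence
    ; ∨-comm = ∧-comm ; ∨-assoc = ∧-assoc ; ∨-cong = ∧-cong
    ; ∧-comm = ∨-comm ; ∧-assoc = ∨-assoc ; ∧-cong = ∨-cong
    ; absorptive = swap absorptive } }
  where open FinLattice L ; open IsLattice isLattice

module _ (L : FinLattice) where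
  open FinLattice L

  Elt : Set
  Elt = Fin (suc n)

  _≤_ : Elt → Elt → Set
  x ≤ y = (x ∧ y) ≡ x

  _≤?_ : (x y : Elt) → Dec (x ≤ y)
  x ≤? y = (x ∧ y) ≟ x

  _⋖_ : Elt → Elt → Set
  u ⋖ v = u ≤ v × u ≢ v × (∀ w → u ≤ w → w ≤ v → w ≡ u ⊎ w ≡ v)

  _⋖?_ : (u v : Elt) → Dec (u ⋖ v)
  u ⋖? v = (u ≤? v) ×-dec ¬? (u ≟ v) ×-dec
           all? (λ w → (u ≤? w) →-dec ((w ≤? v) →-dec ((w ≟ u) ⊎-dec (w ≟ v))))

  bot : Elt
  bot = foldr _∧_ zero (allFin (suc n))

  JoinIrr : Elt → Set
  JoinIrr j = ¬ (∀ y → j ≤ y) × (∀ a b → (a ∨ b) ≡ j → a ≡ j ⊎ b ≡ j)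

  -- The meet is taken
  -- together with x itself, which changes nothing when x has lower covers
  -- and gives x↓ = x = 0̂ for x = 0̂ (the only element without lower covers).
  nucleus : Elt → Elt
  nucleus x = foldr _∧_ x (filter (λ y → y ⋖? x) (allFin (suc n)))

  BRel : Set
  BRel = Elt → Elt → Bool

  IsCongruence : BRel → Set
  IsCongruence θ =
      (∀ a → T (θ a a))
    × (∀ a b → T (θ a b) → T (θ b a))
    × (∀ a b c → T (θ a b) → T (θ b c) → T (θ a c))
    × (∀ a b c d → T (θ a b) → T (θ c d) → T (θ (a ∧ c) (b ∧ d)))
    × (∀ a b c d → T (θ a b) → T (θ c d) → T (θ (a ∨ c) (b ∨ d)))

  _⊑_ : BRel → BRel → Set
  α ⊑ β = ∀ a b → T (α a b) → T (β a b)

  _≐_ : BRel → BRel → Set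
  α ≐ β = ∀ a b → α a b ≡ β a b

  IsCg : Elt → Elt → BRel → Set
  IsCg u v θ = IsCongruence θ × T (θ u v)
             × (∀ θ' → IsCongruence θ' → T (θ' u v) → θ ⊑ θ')

  IsConJoin : BRel → BRel → BRel → Set
  IsConJoin α β θ = IsCongruence θ × α ⊑ θ × β ⊑ θ
                  × (∀ θ' → IsCongruence θ' → α ⊑ θ' → β ⊑ θ' → θ ⊑ θ')

  JoinIrrCon : BRel → Set
  JoinIrrCon θ = IsCongruence θ
               × (∃[ a ] ∃[ b ] (T (θ a b) × a ≢ b))
               × (∀ α β → IsCongruence α → IsCongruence β → IsConJoin α β θ
                     → θ ≐ α ⊎ θ ≐ β)

  IsCgJ : Elt → BRel → Set
  IsCgJ j θ = JoinIrr j × ∃[ c ] (c ⋖ j × IsCg c j θ)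

  CgBijective : Set
  CgBijective =
      (∀ j θ → IsCgJ j θ → JoinIrrCon θ)
    × (∀ j j' θ θ' → IsCgJ j θ → IsCgJ j' θ' → θ ≐ θ' → j ≡ j')
    × (∀ θ → JoinIrrCon θ → ∃[ j ] IsCgJ j θ)

  -- Core label set: j ∈ Ψ(x) iff j = j_{cg(u,v)} for some cover
  -- x↓ ≤ u ⋖ v ≤ x, i.e. j is join-irreducible with cg(j) = cg(u,v).

  InΨ : Elt → Elt → Set
  InΨ x j = ∃[ u ] ∃[ v ] (nucleus x ≤ u × u ⋖ v × v ≤ x
              × ∃[ θ ] (IsCgJ j θ × IsCg u v θ))

  ⋁ : Subset (suc n) → Elt
  ⋁ A = foldr _∨_ bot (filter (λ i → i ∈? A) (allFin (suc n)))

  IsCanonicalJoinRep : Elt → Subset (suc n) → Set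
  IsCanonicalJoinRep x A =
      ⋁ A ≡ x
    × (∀ B → B ⊂ A → ⋁ B ≢ x)
    × (∀ B → ⋁ B ≡ x → ∀ a → a ∈ A → ∃[ b ] (b ∈ B × a ≤ b))

  InΓ : Elt → Elt → Set
  InΓ x j = ∃[ A ] (IsCanonicalJoinRep x A × j ∈ A)

  HasCard : (Elt → Set) → ℕ → Set
  HasCard P k = Σ (List Elt) λ xs → (Unique xs × length xs ≡ k × (∀ y → P y ⇔ y LM.∈ xs))

  BdefIs : ℕ → Set
  BdefIs k = Σ (Elt → ℕ) λ c → ((∀ x → HasCard (λ j → InΨ x j × ¬ InΓ x j) (c x))
                     × sum (map c (allFin (suc n))) ≡ k)

  BooleanInterval : Elt → Elt → Set
  BooleanInterval a b =
    ∃[ k ] Σ (Elt → Subset k) λ f → Σ (Subset k → Elt) λ g →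
        ((∀ (s : Subset k) → a ≤ g s × g s ≤ b)
      × (∀ s → f (g s) ≡ s)
      × (∀ y → a ≤ y → y ≤ b → g (f y) ≡ y)
      × (∀ y y' → a ≤ y → y ≤ b → a ≤ y' → y' ≤ b → (y ≤ y' ⇔ f y ⊆ f y')))

CongruenceUniform : FinLattice → Set
CongruenceUniform L = CgBijective L × CgBijective (dual L)

module Submission where

-- In a congruence-uniform lattice the label j_cg(u,v) of a cover u ⋖ v is the unique minimal element
-- below v but not below u, and the canonical join representation of x consists of the labels of the
-- lower covers of x. If [x↓, x] is Boolean, every cover inside it is perspective to a lower cover of x,
-- hence Ψ(x) ⊆ Γ(x). Conversely, if Ψ(x) ⊆ Γ(x), then z ↦ {lower covers of x not above z} is an order
-- isomorphism from [x↓, x] onto the subsets of lower covers, inverse to taking meets of complements: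
-- a gap between z and the meet would contain a cover whose label lies in Ψ(x) ∖ Γ(x). Finally
-- bdef = 0 says exactly that Ψ(x) ⊆ Γ(x) for every x.

open import Algebra.Lattice.Bundles using (Lattice)
import Algebra.Lattice.Properties.Lattice as LatticeProperties
open import Algebra.Lattice.Structures using (IsLattice)
open import Data.Bool using (T)
open import Data.Bool.Properties using (T-≡)
open import Data.Empty using (⊥-elim)
open import Data.Fin using (Fin; _≟_)
open import Data.Fin.Induction using (po-wellFounded; po-noetherian)
open import Data.Fin.Properties using (all?; any?)
open import Data.Fin.Subset using (Subset; _∈_; _∉_; _⊆_; _⊂_; _∪_; ⁅_⁆; ∁; _-_)
open import Data.Fin.Subset.Properties using (_∈?_; anySubset?; x∈⁅x⁆; x∈⁅y⁆⇒x≡y; x∈p∪q⁺; x∈p∪q⁻; p─q⊆p; x∈p⇒p-x⊂p; x∈p∧x≢y⇒x∈p-y; x∈∁p⇒x∉p; x∉p⇒x∈∁p; x≢y⇒x∉⁅y⁆; ⊆-antisym)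
open import Data.List using (List; []; _∷_; foldr; filter; map; length; allFin)
import Data.List as List
open import Data.List.Membership.Propositional.Properties using (∈-allFin; ∈-filter⁺; ∈-filter⁻; ∈-map⁺; ∈-map⁻; ∈-lookup)
open import Data.List.Relation.Unary.Any using (here; there; index)
open import Data.List.Relation.Unary.Any.Properties using (lookup-index)
open import Data.List.Relation.Unary.Unique.Propositional using (Unique)
open import Data.List.Relation.Unary.Unique.Propositional.Properties using (filter⁺; allFin⁺)
import Data.List.Relation.Unary.AllPairs as AllPairs
import Data.List.Relation.Unary.All as All
open import Data.List.Membership.Propositional using () renaming (_∈_ to _∈ˡ_)
open import Data.Nat using (ℕ; zero; suc)
open import Data.Nat.ListAction using (sum)
open import Data.Nat.Properties using (m+n≡0⇒m≡0; m+n≡0⇒n≡0)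
open import Data.Product using (∃; ∃-syntax; _×_; _,_; proj₁; proj₂)
open import Data.Sum using (_⊎_; inj₁; inj₂)
open import Data.Vec using (Vec; []; _∷_; lookup; tabulate)
open import Data.Vec.Properties using (lookup∘tabulate; []=⇒lookup; lookup⇒[]=)
open import Function using (_∘_)
open import Function.Bundles using (_⇔_; mk⇔; module Equivalence)
open import Induction.WellFounded using (WellFounded; Acc; acc)
open import Relation.Binary using (IsPartialOrder)
import Relation.Binary.Lattice as R
open import Relation.Binary.PropositionalEquality using (_≡_; _≢_; refl; sym; trans; cong; subst; subst₂; isEquivalence)
open import Relation.Nullary using (Dec; yes; no; ¬_)
open import Relation.Nullary.Decidable using (isYes; toWitness; fromWitness; T?; _×-dec_; _→-dec_; ¬?; map′; decidable-stable)
open import Relation.Unary using (Decidable)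

open import Defs using (FinLattice; CongruenceUniform; BdefIs; BooleanInterval; nucleus)
import Defs as D

Searchable : Set → Set₁
Searchable A = ∀ {P : A → Set} → Decidable P → Dec (∀ a → P a)

searchable-Subset : ∀ {k} → Searchable (Subset k)
searchable-Subset P? =
  map′ (λ ∄ s → decidable-stable (P? s) (λ ¬Ps → ∄ (s , ¬Ps)))
       (λ ∀P (s , ¬Ps) → ¬Ps (∀P s))
       (¬? (anySubset? (¬? ∘ P?)))

searchable-Vec : ∀ {A} → Searchable A → ∀ m → Searchable (Vec A m)
searchable-Vec search zero P? = map′ (λ { p [] → p }) (λ ∀P → ∀P []) (P? [])
searchable-Vec search (suc m) P? =
  map′ (λ { ∀P (a ∷ v) → ∀P a v }) (λ ∀P a v → ∀P (a ∷ v))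
       (search (λ a → searchable-Vec search m (P? ∘ (a ∷_))))

module _ {k} {P : Fin k → Set} (P? : Decidable P) where

  subset : Subset k
  subset = tabulate (isYes ∘ P?)

  ∈-subset⁺ : ∀ {i} → P i → i ∈ subset
  ∈-subset⁺ {i} Pi =
    lookup⇒[]= i subset (trans (lookup∘tabulate _ i) (Equivalence.to T-≡ (fromWitness Pi)))

  ∈-subset⁻ : ∀ {i} → i ∈ subset → P i
  ∈-subset⁻ {i} i∈ =
    toWitness (Equivalence.from T-≡ (trans (sym (lookup∘tabulate _ i)) ([]=⇒lookup i∈)))

record Enumeration {m} (P : Fin m → Set) : Set where
  field
    size       : ℕ
    elem       : Fin size → Fin m
    elem-P     : ∀ i → P (elem i)
    injective  : ∀ {i i′} → elem i ≡ elem i′ → i ≡ i′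
    surjective : ∀ {y} → P y → ∃[ i ] elem i ≡ y

lookup-injective : ∀ {A : Set} {xs : List A} → Unique xs →
                   ∀ {i j} → List.lookup xs i ≡ List.lookup xs j → i ≡ j
lookup-injective (_   AllPairs.∷ _) {Fin.zero}  {Fin.zero}  _ = refl
lookup-injective (x∉  AllPairs.∷ _) {Fin.zero}  {Fin.suc j} e = ⊥-elim (All.lookup x∉ (∈-lookup j) e)
lookup-injective (x∉  AllPairs.∷ _) {Fin.suc i} {Fin.zero}  e = ⊥-elim (All.lookup x∉ (∈-lookup i) (sym e))
lookup-injective (_   AllPairs.∷ u) {Fin.suc i} {Fin.suc j} e = cong Fin.suc (lookup-injective u e)

enumeration : ∀ {m} {P : Fin m → Set} → Decidable P → Enumeration P
enumeration {m} P? = record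
  { size       = length ys
  ; elem       = List.lookup ys
  ; elem-P     = λ i → proj₂ (∈-filter⁻ P? {xs = allFin m} (∈-lookup i))
  ; injective  = lookup-injective (filter⁺ P? (allFin⁺ m))
  ; surjective = λ {y} Py → let y∈ = ∈-filter⁺ P? {xs = allFin m} (∈-allFin y) Py
                            in index y∈ , sym (lookup-index y∈)
  }
  where
  ys : List (Fin m)
  ys = filter P? (allFin m)

module _ (L : FinLattice) where
  open FinLattice L using (n; _∧_; _∨_; isLattice)

  Elt : Set
  Elt = D.Elt L

  _≤_ : Elt → Elt → Set
  _≤_ = D._≤_ L

  _≤?_ : ∀ x y → Dec (x ≤ y)
  _≤?_ = D._≤?_ L

  _⋖_ : Elt → Elt → Set
  _⋖_ = D._⋖_ L

  _⋖?_ : ∀ x y → Dec (x ⋖ y)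
  _⋖?_ = D._⋖?_ L

  infix 4 _≤_ _⋖_ _<_

  private
    lattice : Lattice _ _
    lattice = record { isLattice = isLattice }

    module O = R.Lattice (LatticeProperties.∨-∧-orderTheoreticLattice lattice)

  ≤-refl : ∀ {x} → x ≤ x
  ≤-refl = sym O.refl

  ≤-trans : ∀ {x y z} → x ≤ y → y ≤ z → x ≤ z
  ≤-trans p q = sym (O.trans (sym p) (sym q))

  ≤-antisym : ∀ {x y} → x ≤ y → y ≤ x → x ≡ y
  ≤-antisym p q = O.antisym (sym p) (sym q)

  x∧y≤x : ∀ x y → x ∧ y ≤ x
  x∧y≤x x y = sym (O.x∧y≤x x y)

  x∧y≤y : ∀ x y → x ∧ y ≤ y
  x∧y≤y x y = sym (O.x∧y≤y x y)

  ∧-greatest : ∀ {x y z} → x ≤ y → x ≤ z → x ≤ y ∧ z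
  ∧-greatest p q = sym (O.∧-greatest (sym p) (sym q))

  x≤x∨y : ∀ x y → x ≤ x ∨ y
  x≤x∨y x y = sym (O.x≤x∨y x y)

  y≤x∨y : ∀ x y → y ≤ x ∨ y
  y≤x∨y x y = sym (O.y≤x∨y x y)

  ∨-least : ∀ {x y z} → x ≤ z → y ≤ z → x ∨ y ≤ z
  ∨-least p q = sym (O.∨-least (sym p) (sym q))

  ≤-stable : ∀ {x y} → ¬ ¬ (x ≤ y) → x ≤ y
  ≤-stable {x} {y} = decidable-stable (x ≤? y)

  ≤-isPartialOrder : IsPartialOrder _≡_ _≤_
  ≤-isPartialOrder = record
    { isPreorder = record
      { isEquivalence = isEquivalence
      ; reflexive     = λ { refl → ≤-refl }
      ; trans         = ≤-trans }
    ; antisym = ≤-antisym }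

  _<_ : Elt → Elt → Set
  x < y = x ≤ y × x ≢ y

  _<?_ : ∀ x y → Dec (x < y)
  x <? y = (x ≤? y) ×-dec ¬? (x ≟ y)

  Minimal : (Elt → Set) → Elt → Set
  Minimal S m = S m × ∀ w → S w → ¬ w < m

  module _ {S : Elt → Set} (S? : Decidable S) where

    extremal : ∀ {R : Elt → Elt → Set} → WellFounded R → (∀ x y → Dec (R x y)) →
               ∀ {s} → S s → ∃[ m ] (S m × ∀ w → S w → ¬ R w m)
    extremal {R} wf R? {s} = go (wf s)
      where
      go : ∀ {s} → Acc R s → S s → ∃[ m ] (S m × ∀ w → S w → ¬ R w m)
      go {s} (acc below) Ss with any? (λ w → S? w ×-dec R? w s)
      ... | yes (w , Sw , wRs) = go (below wRs) Sw
      ... | no ∄ = s , Ss , λ w Sw wRs → ∄ (w , Sw , wRs)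

    minimal? : Decidable (Minimal S)
    minimal? m = S? m ×-dec all? (λ w → S? w →-dec ¬? (w <? m))

    minimal : ∀ {s} → S s → ∃ (Minimal S)
    minimal = extremal (po-wellFounded ≤-isPartialOrder) _<?_

    maximal : ∀ {s} → S s → ∃[ m ] (S m × ∀ w → S w → ¬ m < w)
    maximal = extremal (po-noetherian ≤-isPartialOrder) (λ x y → y <? x)

  ⋖-above : ∀ {u v w} → u ⋖ v → u ≤ w → w ≤ v → w ≢ u → w ≡ v
  ⋖-above (_ , _ , between) u≤w w≤v w≢u with between _ u≤w w≤v
  ... | inj₁ w≡u = ⊥-elim (w≢u w≡u)
  ... | inj₂ w≡v = w≡v

  ⋖-below : ∀ {u v w} → u ⋖ v → u ≤ w → w ≤ v → w ≢ v → w ≡ u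
  ⋖-below (_ , _ , between) u≤w w≤v w≢v with between _ u≤w w≤v
  ... | inj₁ w≡u = w≡u
  ... | inj₂ w≡v = ⊥-elim (w≢v w≡v)

  ⋖⇒≱ : ∀ {u v} → u ⋖ v → ¬ v ≤ u
  ⋖⇒≱ (u≤v , u≢v , _) v≤u = u≢v (≤-antisym u≤v v≤u)

  lowerCovers-incomparable : ∀ {x y y′} → y ⋖ x → y′ ⋖ x → y ≢ y′ → ¬ y ≤ y′
  lowerCovers-incomparable y⋖x (y′≤x , y′≢x , _) y≢y′ y≤y′ =
    y≢y′ (sym (⋖-below y⋖x y≤y′ y′≤x y′≢x))

  lowerCover-above : ∀ {z x} → z ≤ x → z ≢ x → ∃[ y ] (y ⋖ x × z ≤ y)
  lowerCover-above {z} {x} z≤x z≢x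
    with maximal (λ w → (z ≤? w) ×-dec (w ≤? x) ×-dec ¬? (w ≟ x)) (≤-refl , z≤x , z≢x)
  ... | y , (z≤y , y≤x , y≢x) , y-maximal = y , (y≤x , y≢x , between) , z≤y
    where
    between : ∀ w → y ≤ w → w ≤ x → w ≡ y ⊎ w ≡ x
    between w y≤w w≤x with w ≟ y | w ≟ x
    ... | yes w≡y | _       = inj₁ w≡y
    ... | no _    | yes w≡x = inj₂ w≡x
    ... | no w≢y  | no w≢x  = ⊥-elim (y-maximal w (≤-trans z≤y y≤w , w≤x , w≢x) (y≤w , w≢y ∘ sym))

  no-lowerCover-above⇒≡ : ∀ {z x} → z ≤ x → (∀ {y} → y ⋖ x → ¬ z ≤ y) → z ≡ x
  no-lowerCover-above⇒≡ {z} {x} z≤x none with z ≟ x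
  ... | yes z≡x = z≡x
  ... | no z≢x  = let (y , y⋖x , z≤y) = lowerCover-above z≤x z≢x in ⊥-elim (none y⋖x z≤y)

  foldr-∧-≤-init : ∀ b xs → foldr _∧_ b xs ≤ b
  foldr-∧-≤-init b []       = ≤-refl
  foldr-∧-≤-init b (x ∷ xs) = ≤-trans (x∧y≤y x _) (foldr-∧-≤-init b xs)

  foldr-∧-≤-elem : ∀ b {xs x} → x ∈ˡ xs → foldr _∧_ b xs ≤ x
  foldr-∧-≤-elem b (here refl) = x∧y≤x _ _
  foldr-∧-≤-elem b (there x∈) = ≤-trans (x∧y≤y _ _) (foldr-∧-≤-elem b x∈)

  foldr-∧-greatest : ∀ b xs {z} → z ≤ b → (∀ {x} → x ∈ˡ xs → z ≤ x) → z ≤ foldr _∧_ b xs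
  foldr-∧-greatest b []       z≤b below = z≤b
  foldr-∧-greatest b (x ∷ xs) z≤b below =
    ∧-greatest (below (here refl)) (foldr-∧-greatest b xs z≤b (below ∘ there))

  foldr-∨-≥-elem : ∀ b {xs x} → x ∈ˡ xs → x ≤ foldr _∨_ b xs
  foldr-∨-≥-elem b (here refl) = x≤x∨y _ _
  foldr-∨-≥-elem b (there x∈) = ≤-trans (foldr-∨-≥-elem b x∈) (y≤x∨y _ _)

  foldr-∨-least : ∀ b xs {z} → b ≤ z → (∀ {x} → x ∈ˡ xs → x ≤ z) → foldr _∨_ b xs ≤ z
  foldr-∨-least b []       b≤z above = b≤z
  foldr-∨-least b (x ∷ xs) b≤z above =
    ∨-least (above (here refl)) (foldr-∨-least b xs b≤z (above ∘ there))

  bot-≤ : ∀ x → D.bot L ≤ x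
  bot-≤ x = foldr-∧-≤-elem _ (∈-allFin x)

  ⋁ : Subset (suc n) → Elt
  ⋁ = D.⋁ L

  ⋁-upperBound : ∀ {A a} → a ∈ A → a ≤ ⋁ A
  ⋁-upperBound {A} {a} a∈A = foldr-∨-≥-elem _ (∈-filter⁺ (_∈? A) {xs = allFin _} (∈-allFin a) a∈A)

  ⋁-least : ∀ {A z} → (∀ {a} → a ∈ A → a ≤ z) → ⋁ A ≤ z
  ⋁-least {A} {z} above = foldr-∨-least _ _ (bot-≤ z) (above ∘ proj₂ ∘ ∈-filter⁻ (_∈? A) {xs = allFin _})

  ⋁≡-≰-lowerCover : ∀ {B x y} → ⋁ B ≡ x → y ⋖ x → ¬ (∀ {b} → b ∈ B → b ≤ y)
  ⋁≡-≰-lowerCover ⋁B≡x y⋖x all≤y = ⋖⇒≱ y⋖x (subst (_≤ _) ⋁B≡x (⋁-least all≤y))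

  nucleus-≤ : ∀ x → nucleus L x ≤ x
  nucleus-≤ x = foldr-∧-≤-init x (filter (_⋖? x) (allFin (suc n)))

  nucleus-≤-lowerCover : ∀ {x y} → y ⋖ x → nucleus L x ≤ y
  nucleus-≤-lowerCover {x} {y} y⋖x = foldr-∧-≤-elem x (∈-filter⁺ (_⋖? x) {xs = allFin _} (∈-allFin y) y⋖x)

  module _ {k} (b : Elt) (f : Fin k → Elt) where

    ⋀ : Subset k → Elt
    ⋀ s = foldr _∧_ b (map f (filter (_∈? s) (allFin k)))

    ⋀-≤-init : ∀ s → ⋀ s ≤ b
    ⋀-≤-init s = foldr-∧-≤-init b (map f (filter (_∈? s) (allFin k)))

    ⋀-≤-elem : ∀ {s i} → i ∈ s → ⋀ s ≤ f i
    ⋀-≤-elem {s} {i} i∈s =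
      foldr-∧-≤-elem b (∈-map⁺ f (∈-filter⁺ (_∈? s) {xs = allFin k} (∈-allFin i) i∈s))

    ⋀-greatest : ∀ s {z} → z ≤ b → (∀ {i} → i ∈ s → z ≤ f i) → z ≤ ⋀ s
    ⋀-greatest s {z} z≤b below = foldr-∧-greatest b _ z≤b below-elem
      where
      below-elem : ∀ {x} → x ∈ˡ map f (filter (_∈? s) (allFin k)) → z ≤ x
      below-elem x∈ with ∈-map⁻ f x∈
      ... | i , i∈ , refl = below (proj₂ (∈-filter⁻ (_∈? s) {xs = allFin k} i∈))

  BRel : Set
  BRel = D.BRel L

  IsCongruence : BRel → Set
  IsCongruence = D.IsCongruence L

  IsCg : Elt → Elt → BRel → Set
  IsCg = D.IsCg L

  congruence? : Decidable IsCongruence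
  congruence? θ =
          all? (λ a → T? (θ a a))
    ×-dec all? (λ a → all? λ b → T? (θ a b) →-dec T? (θ b a))
    ×-dec all? (λ a → all? λ b → all? λ c → T? (θ a b) →-dec T? (θ b c) →-dec T? (θ a c))
    ×-dec all? (λ a → all? λ b → all? λ c → all? λ d →
            T? (θ a b) →-dec T? (θ c d) →-dec T? (θ (a ∧ c) (b ∧ d)))
    ×-dec all? (λ a → all? λ b → all? λ c → all? λ d →
            T? (θ a b) →-dec T? (θ c d) →-dec T? (θ (a ∨ c) (b ∨ d)))

  IsCongruence-resp : ∀ {α β} → D._≐_ L α β → IsCongruence α → IsCongruence β
  IsCongruence-resp {α} {β} α≐β (refl′ , sym′ , trans′ , ∧-compat , ∨-compat) =
      (λ a → to (refl′ a))
    , (λ a b p → to (sym′ a b (from p)))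
    , (λ a b c p q → to (trans′ a b c (from p) (from q)))
    , (λ a b c d p q → to (∧-compat a b c d (from p) (from q)))
    , (λ a b c d p q → to (∨-compat a b c d (from p) (from q)))
    where
    to : ∀ {a b} → T (α a b) → T (β a b)
    to {a} {b} = subst T (α≐β a b)
    from : ∀ {a b} → T (β a b) → T (α a b)
    from {a} {b} = subst T (sym (α≐β a b))

  Matrix : Set
  Matrix = Vec (Subset (suc n)) (suc n)

  relation : Matrix → BRel
  relation M a b = lookup (lookup M a) b

  matrix : BRel → Matrix
  matrix θ = tabulate (tabulate ∘ θ)

  relation-matrix : ∀ θ → D._≐_ L (relation (matrix θ)) θ
  relation-matrix θ a b rewrite lookup∘tabulate (tabulate ∘ θ) a = lookup∘tabulate (θ a) b

  -- cg p q relates a and b iff every congruence relating p and q does; the quantifier is decidable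
  -- because it ranges over the finitely many boolean matrices.
  cg : Elt → Elt → BRel
  cg p q a b = isYes (searchable-Vec searchable-Subset (suc n) λ M →
    congruence? (relation M) →-dec T? (relation M p q) →-dec T? (relation M a b))

  cg-intro : ∀ {p q a b} → (∀ θ → IsCongruence θ → T (θ p q) → T (θ a b)) → T (cg p q a b)
  cg-intro forced = fromWitness λ M → forced (relation M)

  cg-elim : ∀ {p q a b} → T (cg p q a b) → ∀ θ → IsCongruence θ → T (θ p q) → T (θ a b)
  cg-elim {p} {q} {a} {b} t θ C θpq =
    subst T (relation-matrix θ a b)
      (toWitness t (matrix θ) (IsCongruence-resp (λ a b → sym (relation-matrix θ a b)) C)
                              (subst T (sym (relation-matrix θ p q)) θpq))

  cg-isCg : ∀ p q → IsCg p q (cg p q)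
  cg-isCg p q = isCongruence , cg-intro (λ _ _ θpq → θpq) , λ θ C θpq a b t → cg-elim t θ C θpq
    where
    isCongruence : IsCongruence (cg p q)
    isCongruence =
        (λ a → cg-intro λ { θ (r , _) _ → r a })
      , (λ a b t → cg-intro λ { θ C@(_ , s , _) θpq → s a b (cg-elim t θ C θpq) })
      , (λ a b c t u → cg-intro λ { θ C@(_ , _ , tr , _) θpq →
            tr a b c (cg-elim t θ C θpq) (cg-elim u θ C θpq) })
      , (λ a b c d t u → cg-intro λ { θ C@(_ , _ , _ , m , _) θpq →
            m a b c d (cg-elim t θ C θpq) (cg-elim u θ C θpq) })
      , (λ a b c d t u → cg-intro λ { θ C@(_ , _ , _ , _ , j) θpq →
            j a b c d (cg-elim t θ C θpq) (cg-elim u θ C θpq) })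

  ≤⇒∨≡ : ∀ {x y} → x ≤ y → x ∨ y ≡ y
  ≤⇒∨≡ x≤y = ≤-antisym (∨-least x≤y ≤-refl) (y≤x∨y _ _)

  ≤⇒∧≡ʳ : ∀ {x y} → x ≤ y → y ∧ x ≡ x
  ≤⇒∧≡ʳ {x} {y} x≤y = trans (IsLattice.∧-comm isLattice y x) x≤y

  related-perspective : ∀ {a y x c θ} → a ∨ y ≡ x → a ∧ y ≡ c → IsCongruence θ →
                        T (θ y x) ⇔ T (θ c a)
  related-perspective {a} {y} {x} {c} {θ} a∨y≡x a∧y≡c (refl′ , _ , _ , ∧-compat , ∨-compat) =
    mk⇔ (λ θyx → subst₂ (λ u v → T (θ u v)) y∧a≡c x∧a≡a (∧-compat y x a a θyx (refl′ a)))
        (λ θca → subst₂ (λ u v → T (θ u v)) c∨y≡y a∨y≡x (∨-compat c a y y θca (refl′ y)))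
    where
    y∧a≡c : y ∧ a ≡ c
    y∧a≡c = trans (IsLattice.∧-comm isLattice y a) a∧y≡c
    x∧a≡a : x ∧ a ≡ a
    x∧a≡a = ≤⇒∧≡ʳ (subst (a ≤_) a∨y≡x (x≤x∨y a y))
    c∨y≡y : c ∨ y ≡ y
    c∨y≡y = ≤⇒∨≡ (subst (_≤ y) a∧y≡c (x∧y≤y a y))

  cg-perspective : ∀ {a y x c θ} → a ∨ y ≡ x → a ∧ y ≡ c → IsCg y x θ ⇔ IsCg c a θ
  cg-perspective {a} {y} {x} {c} a∨y≡x a∧y≡c =
    mk⇔ (λ (C , θyx , least) → C , to (persp C) θyx , λ θ′ C′ → least θ′ C′ ∘ from (persp C′))
        (λ (C , θca , least) → C , from (persp C) θca , λ θ′ C′ → least θ′ C′ ∘ to (persp C′))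
    where
    open Equivalence
    persp : ∀ {θ} → IsCongruence θ → T (θ y x) ⇔ T (θ c a)
    persp = related-perspective a∨y≡x a∧y≡c

  JoinIrr : Elt → Set
  JoinIrr = D.JoinIrr L

  IsCgJ : Elt → BRel → Set
  IsCgJ = D.IsCgJ L

  -- For a cover p ⋖ q in a congruence-uniform lattice, Label p q holds exactly of j_cg(p,q).
  Label : Elt → Elt → Elt → Set
  Label p q = Minimal (λ w → w ≤ q × ¬ w ≤ p)

  label? : ∀ p q → Decidable (Label p q)
  label? p q = minimal? (λ w → (w ≤? q) ×-dec ¬? (w ≤? p))

  label-<⇒≤ : ∀ {p q t w} → Label p q t → w < t → w ≤ p
  label-<⇒≤ ((t≤q , _) , t-minimal) w<t@(w≤t , _) =
    ≤-stable λ w≰p → t-minimal _ (≤-trans w≤t t≤q , w≰p) w<t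

  label-joinIrr : ∀ {p q t} → Label p q t → JoinIrr t
  label-joinIrr {p} {q} {t} ℓ@((_ , t≰p) , _) = (λ t≤all → t≰p (t≤all p)) , irreducible
    where
    irreducible : ∀ a b → a ∨ b ≡ t → a ≡ t ⊎ b ≡ t
    irreducible a b a∨b≡t with a ≟ t | b ≟ t
    ... | yes a≡t | _       = inj₁ a≡t
    ... | no _    | yes b≡t = inj₂ b≡t
    ... | no a≢t  | no b≢t  = ⊥-elim (t≰p (subst (_≤ p) a∨b≡t (∨-least
            (label-<⇒≤ ℓ (subst (a ≤_) a∨b≡t (x≤x∨y a b) , a≢t))
            (label-<⇒≤ ℓ (subst (b ≤_) a∨b≡t (y≤x∨y a b) , b≢t)))))

  label-⋖ : ∀ {p q t} → Label p q t → t ∧ p ⋖ t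
  label-⋖ {p} {q} {t} ℓ@((_ , t≰p) , _) = x∧y≤x t p , t≰p , between
    where
    between : ∀ w → t ∧ p ≤ w → w ≤ t → w ≡ t ∧ p ⊎ w ≡ t
    between w t∧p≤w w≤t with w ≟ t
    ... | yes w≡t = inj₂ w≡t
    ... | no w≢t  = inj₁ (≤-antisym (∧-greatest w≤t (label-<⇒≤ ℓ (w≤t , w≢t))) t∧p≤w)

  module _ {p q} (p⋖q : p ⋖ q) where

    label-exists : ∃ (Label p q)
    label-exists = minimal (λ w → (w ≤? q) ×-dec ¬? (w ≤? p)) (≤-refl , ⋖⇒≱ p⋖q)

    label-∨ : ∀ {t} → Label p q t → t ∨ p ≡ q
    label-∨ {t} ((t≤q , t≰p) , _) =
      ⋖-above p⋖q (y≤x∨y t p) (∨-least t≤q (proj₁ p⋖q))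
        λ t∨p≡p → t≰p (subst (t ≤_) t∨p≡p (x≤x∨y t p))

    label-cgJ : ∀ {t θ} → Label p q t → IsCg p q θ → IsCgJ t θ
    label-cgJ ℓ p⋖qθ =
      label-joinIrr ℓ , _ , label-⋖ ℓ , Equivalence.to (cg-perspective (label-∨ ℓ) refl) p⋖qθ

  -- In 2^k, a set not contained in another is separated from it by a coatom: the complement of a point.
  boolean-coatom-separates : ∀ {a b z w} → BooleanInterval L a b →
                             a ≤ z → z ≤ b → a ≤ w → w ≤ b → ¬ w ≤ z →
                             ∃[ y ] (y ⋖ b × z ≤ y × ¬ w ≤ y)
  boolean-coatom-separates {a} {b} {z} {w} (k , f , g , g-in , f∘g , _ , ≤⇔⊆) a≤z z≤b a≤w w≤b w≰z
    with any? (λ i → (i ∈? f w) ×-dec ¬? (i ∈? f z))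
  ... | no ∄ = ⊥-elim (w≰z (Equivalence.from (≤⇔⊆ w z a≤w w≤b a≤z z≤b)
                 λ {i} i∈fw → decidable-stable (i ∈? f z) λ i∉fz → ∄ (i , i∈fw , i∉fz)))
  ... | yes (i , i∈fw , i∉fz) = y , (y≤b , y≢b , between) , below-y a≤z z≤b i∉fz , w≰y
    where
    co : Subset k
    co = ∁ ⁅ i ⁆
    y : Elt
    y = g co
    a≤y : a ≤ y
    a≤y = proj₁ (g-in co)
    y≤b : y ≤ b
    y≤b = proj₂ (g-in co)
    ≤y⇔⊆co : ∀ {t} → a ≤ t → t ≤ b → t ≤ y ⇔ f t ⊆ co
    ≤y⇔⊆co {t} a≤t t≤b = subst (λ s → t ≤ y ⇔ f t ⊆ s) (f∘g co) (≤⇔⊆ t y a≤t t≤b a≤y y≤b)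
    below-y : ∀ {t} → a ≤ t → t ≤ b → i ∉ f t → t ≤ y
    below-y a≤t t≤b i∉ft = Equivalence.from (≤y⇔⊆co a≤t t≤b)
      λ i′∈ft → x∉p⇒x∈∁p (x≢y⇒x∉⁅y⁆ λ { refl → i∉ft i′∈ft })
    not-below-y : ∀ {t} → a ≤ t → t ≤ b → i ∈ f t → ¬ t ≤ y
    not-below-y a≤t t≤b i∈ft t≤y = x∈∁p⇒x∉p (Equivalence.to (≤y⇔⊆co a≤t t≤b) t≤y i∈ft) (x∈⁅x⁆ i)
    w≰y : ¬ w ≤ y
    w≰y = not-below-y a≤w w≤b i∈fw
    y≢b : y ≢ b
    y≢b y≡b = w≰y (subst (w ≤_) (sym y≡b) w≤b)
    between : ∀ t → y ≤ t → t ≤ b → t ≡ y ⊎ t ≡ b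
    between t y≤t t≤b with i ∈? f t | ≤-trans a≤y y≤t
    ... | no i∉ft  | a≤t = inj₁ (≤-antisym (below-y a≤t t≤b i∉ft) y≤t)
    ... | yes i∈ft | a≤t = inj₂ (≤-antisym t≤b (Equivalence.from (≤⇔⊆ b t a≤b ≤-refl a≤t t≤b) fb⊆ft))
      where
      a≤b : a ≤ b
      a≤b = ≤-trans a≤y y≤b
      fb⊆ft : f b ⊆ f t
      fb⊆ft {i′} i′∈fb with i′ ≟ i
      ... | yes refl = i∈ft
      ... | no i′≢i  = Equivalence.to (≤⇔⊆ y t a≤y y≤b a≤t t≤b) y≤t
                         (subst (i′ ∈_) (sym (f∘g co)) (x∉p⇒x∈∁p (x≢y⇒x∉⁅y⁆ i′≢i)))

  LowerLabel : Elt → Elt → Set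
  LowerLabel x t = ∃[ y ] (y ⋖ x × Label y x t)

  lowerLabel? : ∀ x → Decidable (LowerLabel x)
  lowerLabel? x t = any? λ y → (y ⋖? x) ×-dec label? y x t

  lowerLabel-≤ : ∀ {x t} → LowerLabel x t → t ≤ x
  lowerLabel-≤ (_ , _ , (t≤x , _) , _) = t≤x

  lowerLabels : Elt → Subset (suc n)
  lowerLabels x = subset (lowerLabel? x)

  CgInjective : Set
  CgInjective = ∀ {j j′ θ} → IsCgJ j θ → IsCgJ j′ θ → j ≡ j′

  congruenceUniform⇒cgInjective : CongruenceUniform L → CgInjective
  congruenceUniform⇒cgInjective ((_ , injective , _) , _) jθ j′θ = injective _ _ _ _ jθ j′θ λ _ _ → refl

  module _ (cg-injective : CgInjective) where

    module _ {p q} (p⋖q : p ⋖ q) where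

      label-unique : ∀ {t t′} → Label p q t → Label p q t′ → t ≡ t′
      label-unique ℓ ℓ′ = cg-injective (label-cgJ p⋖q ℓ (cg-isCg p q)) (label-cgJ p⋖q ℓ′ (cg-isCg p q))

      label-least : ∀ {t z} → Label p q t → z ≤ q → ¬ z ≤ p → t ≤ z
      label-least {t} {z} ℓ z≤q z≰p
        with minimal (λ w → ((w ≤? q) ×-dec ¬? (w ≤? p)) ×-dec (w ≤? z)) ((z≤q , z≰p) , ≤-refl)
      ... | t′ , (t′∈ , t′≤z) , t′-minimal = subst (_≤ z) (label-unique ℓ′ ℓ) t′≤z
        where
        ℓ′ : Label p q t′
        ℓ′ = t′∈ , λ w w∈ w<t′ → t′-minimal w (w∈ , ≤-trans (proj₁ w<t′) t′≤z) w<t′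

      cgJ-label : ∀ {θ j} → IsCg p q θ → IsCgJ j θ → Label p q j
      cgJ-label p⋖qθ jθ =
        let (t , ℓ) = label-exists p⋖q in subst (Label p q) (cg-injective (label-cgJ p⋖q ℓ p⋖qθ) jθ) ℓ

    module _ {x : Elt} where

      ⋁-lowerLabels : ⋁ (lowerLabels x) ≡ x
      ⋁-lowerLabels =
        no-lowerCover-above⇒≡ (⋁-least (lowerLabel-≤ ∘ ∈-subset⁻ (lowerLabel? x))) λ {y} y⋖x ⋁≤y →
        let (t , ℓ@((_ , t≰y) , _)) = label-exists y⋖x
        in t≰y (≤-trans (⋁-upperBound (∈-subset⁺ (lowerLabel? x) (y , y⋖x , ℓ))) ⋁≤y)

      lowerLabels-irredundant : ∀ B → B ⊂ lowerLabels x → ⋁ B ≢ x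
      lowerLabels-irredundant B (B⊆ , a , a∈ , a∉B) ⋁B≡x
        with ∈-subset⁻ (lowerLabel? x) a∈
      ... | y , y⋖x@(y≤x , _) , ℓ = ⋁≡-≰-lowerCover ⋁B≡x y⋖x below-y
        where
        below-y : ∀ {b} → b ∈ B → b ≤ y
        below-y b∈B with ∈-subset⁻ (lowerLabel? x) (B⊆ b∈B)
        ... | y′ , y′⋖x , ℓ′ with y′ ≟ y
        ...   | yes refl = ⊥-elim (a∉B (subst (_∈ B) (label-unique y⋖x ℓ′ ℓ) b∈B))
        ...   | no y′≢y  = label-least y′⋖x ℓ′ y≤x (lowerCovers-incomparable y⋖x y′⋖x (y′≢y ∘ sym))

      lowerLabels-refine : ∀ B → ⋁ B ≡ x → ∀ a → a ∈ lowerLabels x → ∃[ b ] (b ∈ B × a ≤ b)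
      lowerLabels-refine B ⋁B≡x a a∈ with ∈-subset⁻ (lowerLabel? x) a∈
      ... | y , y⋖x , ℓ with any? (λ b → (b ∈? B) ×-dec ¬? (b ≤? y))
      ...   | yes (b , b∈B , b≰y) =
        b , b∈B , label-least y⋖x ℓ (subst (b ≤_) ⋁B≡x (⋁-upperBound b∈B)) b≰y
      ...   | no ∄ =
        ⊥-elim (⋁≡-≰-lowerCover ⋁B≡x y⋖x λ {b} b∈B → ≤-stable λ b≰y → ∄ (b , b∈B , b≰y))

      lowerLabels-canonical : D.IsCanonicalJoinRep L x (lowerLabels x)
      lowerLabels-canonical = ⋁-lowerLabels , lowerLabels-irredundant , lowerLabels-refine

      canonical-≤ : ∀ {A a} → D.IsCanonicalJoinRep L x A → a ∈ A → a ≤ x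
      canonical-≤ (⋁A≡x , _) a∈A = subst (_ ≤_) ⋁A≡x (⋁-upperBound a∈A)

      -- {y, t} joins to x, so refinement forces j ≤ t, while t ≤ j as j lies below x but not below y.
      canonical-label : ∀ {A j y t} → D.IsCanonicalJoinRep L x A → j ∈ A → y ⋖ x → ⋁ (A - j) ≤ y →
                        Label y x t → t ≡ j
      canonical-label {A} {j} {y} {t} canon@(⋁A≡x , _ , refine) j∈A y⋖x@(y≤x , _) ⋁A-j≤y ℓ =
        ≤-antisym (label-least y⋖x ℓ (canonical-≤ canon j∈A) j≰y) (j≤t (refine B ⋁B≡x j j∈A))
        where
        j≰y : ¬ j ≤ y
        j≰y j≤y = ⋁≡-≰-lowerCover ⋁A≡x y⋖x below-y
          where
          below-y : ∀ {a} → a ∈ A → a ≤ y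
          below-y {a} a∈A with a ≟ j
          ... | yes refl = j≤y
          ... | no a≢j   = ≤-trans (⋁-upperBound (x∈p∧x≢y⇒x∈p-y a∈A a≢j)) ⋁A-j≤y
        B : Subset (suc n)
        B = ⁅ y ⁆ ∪ ⁅ t ⁆
        B≤x : ∀ {b} → b ∈ B → b ≤ x
        B≤x {b} b∈B with x∈p∪q⁻ ⁅ y ⁆ ⁅ t ⁆ b∈B
        ... | inj₁ b∈⁅y⁆ = subst (_≤ x) (sym (x∈⁅y⁆⇒x≡y y b∈⁅y⁆)) y≤x
        ... | inj₂ b∈⁅t⁆ = subst (_≤ x) (sym (x∈⁅y⁆⇒x≡y t b∈⁅t⁆)) (lowerLabel-≤ (y , y⋖x , ℓ))
        ⋁B≡x : ⋁ B ≡ x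
        ⋁B≡x = ⋖-above y⋖x (⋁-upperBound y∈B) (⋁-least B≤x) λ ⋁B≡y →
          proj₂ (proj₁ ℓ) (subst (t ≤_) ⋁B≡y (⋁-upperBound t∈B))
          where
          y∈B : y ∈ B
          y∈B = x∈p∪q⁺ (inj₁ (x∈⁅x⁆ y))
          t∈B : t ∈ B
          t∈B = x∈p∪q⁺ (inj₂ (x∈⁅x⁆ t))
        j≤t : ∃[ b ] (b ∈ B × j ≤ b) → j ≤ t
        j≤t (b , b∈B , j≤b) with x∈p∪q⁻ ⁅ y ⁆ ⁅ t ⁆ b∈B
        ... | inj₁ b∈⁅y⁆ = ⊥-elim (j≰y (subst (j ≤_) (x∈⁅y⁆⇒x≡y y b∈⁅y⁆) j≤b))
        ... | inj₂ b∈⁅t⁆ = subst (j ≤_) (x∈⁅y⁆⇒x≡y t b∈⁅t⁆) j≤b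

      canonical⇒lowerLabel : ∀ {j} → D.InΓ L x j → LowerLabel x j
      canonical⇒lowerLabel {j} (A , canon@(_ , irredundant , _) , j∈A) =
        let (y , y⋖x , ⋁A-j≤y) = lowerCover-above (⋁-least (canonical-≤ canon ∘ p─q⊆p A ⁅ j ⁆))
                                                  (irredundant (A - j) (x∈p⇒p-x⊂p j∈A))
            (t , ℓ) = label-exists y⋖x
        in y , y⋖x , subst (Label y x) (canonical-label canon j∈A y⋖x ⋁A-j≤y ℓ) ℓ

    -- v ∨ y = x and v ∧ y = u make the cover u ⋖ v perspective to y ⋖ x, so both have the label j.
    boolean⇒core⊆canonical : ∀ {x j} → BooleanInterval L (nucleus L x) x → D.InΨ L x j → D.InΓ L x j
    boolean⇒core⊆canonical {x} boolean (u , v , x↓≤u , u⋖v@(u≤v , _) , v≤x , θ , jθ , u⋖vθ)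
      with boolean-coatom-separates boolean x↓≤u (≤-trans u≤v v≤x) (≤-trans x↓≤u u≤v) v≤x (⋖⇒≱ u⋖v)
    ... | y , y⋖x@(y≤x , _) , u≤y , v≰y =
      lowerLabels x , lowerLabels-canonical , ∈-subset⁺ (lowerLabel? x) (y , y⋖x , cgJ-label y⋖x y⋖xθ jθ)
      where
      v∨y≡x : v ∨ y ≡ x
      v∨y≡x = ⋖-above y⋖x (y≤x∨y v y) (∨-least v≤x y≤x)
                λ v∨y≡y → v≰y (subst (v ≤_) v∨y≡y (x≤x∨y v y))
      v∧y≡u : v ∧ y ≡ u
      v∧y≡u = ⋖-below u⋖v (∧-greatest u≤v u≤y) (x∧y≤x v y)
                λ v∧y≡v → v≰y (subst (_≤ y) v∧y≡v (x∧y≤y v y))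
      y⋖xθ : IsCg y x θ
      y⋖xθ = Equivalence.from (cg-perspective v∨y≡x v∧y≡u) u⋖vθ

    module _ {x : Elt} (Ψ∖Γ-empty : ∀ j → ¬ (D.InΨ L x j × ¬ D.InΓ L x j)) where

      open Enumeration (enumeration (_⋖? x)) renaming (elem to cover; elem-P to cover-⋖)

      uncovered : Elt → Subset size
      uncovered z = subset (λ i → ¬? (z ≤? cover i))

      ∈-uncovered⁺ : ∀ {z i} → ¬ z ≤ cover i → i ∈ uncovered z
      ∈-uncovered⁺ {z} = ∈-subset⁺ (λ i → ¬? (z ≤? cover i))

      ∈-uncovered⁻ : ∀ {z i} → i ∈ uncovered z → ¬ z ≤ cover i
      ∈-uncovered⁻ {z} = ∈-subset⁻ (λ i → ¬? (z ≤? cover i))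

      ≤-cover : ∀ {z i} → i ∉ uncovered z → z ≤ cover i
      ≤-cover i∉ = ≤-stable (i∉ ∘ ∈-uncovered⁺)

      meet : Subset size → Elt
      meet s = ⋀ x cover (∁ s)

      meet-≤ : ∀ s → meet s ≤ x
      meet-≤ s = ⋀-≤-init x cover (∁ s)

      meet-≤-cover : ∀ {s i} → i ∉ s → meet s ≤ cover i
      meet-≤-cover i∉s = ⋀-≤-elem x cover (x∉p⇒x∈∁p i∉s)

      ≤-meet : ∀ {s z} → z ≤ x → (∀ {i} → i ∉ s → z ≤ cover i) → z ≤ meet s
      ≤-meet {s} z≤x below = ⋀-greatest x cover (∁ s) z≤x (below ∘ x∈∁p⇒x∉p)

      nucleus-≤-meet : ∀ s → nucleus L x ≤ meet s
      nucleus-≤-meet s = ≤-meet (nucleus-≤ x) λ {i} _ → nucleus-≤-lowerCover (cover-⋖ i)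

      meet-mono : ∀ {s s′} → s ⊆ s′ → meet s ≤ meet s′
      meet-mono s⊆s′ = ≤-meet (meet-≤ _) λ i∉s′ → meet-≤-cover (i∉s′ ∘ s⊆s′)

      -- The label of yᵢ ⋖ x lies below every other lower cover, hence below meet s, but not below yᵢ.
      meet-≰-cover : ∀ {s i} → i ∈ s → ¬ meet s ≤ cover i
      meet-≰-cover {s} {i} i∈s meet≤yᵢ =
        let (t , ℓ@((t≤x , t≰yᵢ) , _)) = label-exists (cover-⋖ i)
            t≤meet = ≤-meet t≤x λ {i′} i′∉s → label-least (cover-⋖ i) ℓ (proj₁ (cover-⋖ i′))
                       (lowerCovers-incomparable (cover-⋖ i′) (cover-⋖ i) λ yᵢ′≡yᵢ →
                          i′∉s (subst (_∈ s) (injective (sym yᵢ′≡yᵢ)) i∈s))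
        in t≰yᵢ (≤-trans t≤meet meet≤yᵢ)

      uncovered-meet : ∀ s → uncovered (meet s) ≡ s
      uncovered-meet s = ⊆-antisym
        (λ {i} i∈ → decidable-stable (i ∈? s) λ i∉s → ∈-uncovered⁻ i∈ (meet-≤-cover i∉s))
        (λ i∈s → ∈-uncovered⁺ (meet-≰-cover i∈s))

      ≤-meet-uncovered : ∀ {z} → z ≤ x → z ≤ meet (uncovered z)
      ≤-meet-uncovered z≤x = ≤-meet z≤x ≤-cover

      -- A cover u ⋖ w with z ≤ u inside [z, meet (uncovered z)] would have a core label outside Γ(x).
      meet-uncovered : ∀ {z} → nucleus L x ≤ z → z ≤ x → meet (uncovered z) ≡ z
      meet-uncovered {z} x↓≤z z≤x = sym (no-lowerCover-above⇒≡ (≤-meet-uncovered z≤x) gap-free)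
        where
        w : Elt
        w = meet (uncovered z)
        core-label : ∀ {u j} → z ≤ u → u ⋖ w → Label u w j → D.InΨ L x j
        core-label {u} z≤u u⋖w ℓ =
          u , w , ≤-trans x↓≤z z≤u , u⋖w , meet-≤ _ ,
          cg u w , label-cgJ u⋖w ℓ (cg-isCg u w) , cg-isCg u w
        not-lowerLabel : ∀ {u j} → z ≤ u → Label u w j → ¬ LowerLabel x j
        not-lowerLabel z≤u ((j≤w , j≰u) , _) (y , y⋖x , ℓ@((_ , j≰y) , _))
          with surjective y⋖x | z ≤? y
        ... | i , refl | yes z≤y = j≰y (≤-trans j≤w (meet-≤-cover λ i∈ → ∈-uncovered⁻ i∈ z≤y))
        ... | i , refl | no z≰y  = j≰u (≤-trans (label-least y⋖x ℓ z≤x z≰y) z≤u)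
        gap-free : ∀ {u} → u ⋖ w → ¬ z ≤ u
        gap-free u⋖w z≤u =
          let (j , ℓ) = label-exists u⋖w
          in Ψ∖Γ-empty j (core-label z≤u u⋖w ℓ , not-lowerLabel z≤u ℓ ∘ canonical⇒lowerLabel)

      boolean-nucleus : BooleanInterval L (nucleus L x) x
      boolean-nucleus =
          size , uncovered , meet , (λ s → nucleus-≤-meet s , meet-≤ s) , uncovered-meet
        , (λ z x↓≤z z≤x → meet-uncovered x↓≤z z≤x) , ≤⇔⊆
        where
        ≤⇔⊆ : ∀ z z′ → nucleus L x ≤ z → z ≤ x → nucleus L x ≤ z′ → z′ ≤ x →
              z ≤ z′ ⇔ uncovered z ⊆ uncovered z′
        ≤⇔⊆ z z′ x↓≤z z≤x x↓≤z′ z′≤x = mk⇔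
          (λ z≤z′ {i} i∈ → ∈-uncovered⁺ λ z′≤yᵢ → ∈-uncovered⁻ i∈ (≤-trans z≤z′ z′≤yᵢ))
          (λ (⊆ : uncovered z ⊆ uncovered z′) →
             subst₂ _≤_ (meet-uncovered x↓≤z z≤x) (meet-uncovered x↓≤z′ z′≤x) (meet-mono ⊆))

sum-map-≡0 : ∀ {A : Set} (c : A → ℕ) {xs y} → sum (map c xs) ≡ 0 → y ∈ˡ xs → c y ≡ 0
sum-map-≡0 c {x ∷ _} sum≡0 (here refl) = m+n≡0⇒m≡0 (c x) sum≡0
sum-map-≡0 c {x ∷ _} sum≡0 (there y∈) = sum-map-≡0 c (m+n≡0⇒n≡0 (c x) sum≡0) y∈

sum-map-0 : ∀ {A : Set} (xs : List A) → sum (map (λ _ → 0) xs) ≡ 0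
sum-map-0 []       = refl
sum-map-0 (_ ∷ xs) = sum-map-0 xs

module _ {L : FinLattice} {P : D.Elt L → Set} where

  hasCard-0⇒empty : D.HasCard L P 0 → ∀ y → ¬ P y
  hasCard-0⇒empty ([] , _ , _ , P⇔∈) y Py with Equivalence.to (P⇔∈ y) Py
  ... | ()

  empty⇒hasCard-0 : (∀ y → ¬ P y) → D.HasCard L P 0
  empty⇒hasCard-0 empty = [] , AllPairs.[] , refl , λ y → mk⇔ (⊥-elim ∘ empty y) λ ()

bdef-0⇔Ψ∖Γ-empty : ∀ L → BdefIs L 0 ⇔ (∀ x j → ¬ (D.InΨ L x j × ¬ D.InΓ L x j))
bdef-0⇔Ψ∖Γ-empty L = mk⇔
  (λ (c , card , sum≡0) x →
     hasCard-0⇒empty {L} (subst (D.HasCard L (λ j → D.InΨ L x j × ¬ D.InΓ L x j))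
                                (sum-map-≡0 c sum≡0 (∈-allFin x)) (card x)))
  (λ Ψ∖Γ-empty →
     (λ _ → 0) , (λ x → empty⇒hasCard-0 {L} (Ψ∖Γ-empty x)) , sum-map-0 (allFin (suc (FinLattice.n L))))

proposition5p2 : (L : FinLattice) → CongruenceUniform L →
    (BdefIs L 0 ⇔ (∀ x → BooleanInterval L (nucleus L x) x))
proposition5p2 L cu = mk⇔
  (λ bdef-0 x → boolean-nucleus L cg-injective (to (bdef-0⇔Ψ∖Γ-empty L) bdef-0 x))
  (λ boolean → from (bdef-0⇔Ψ∖Γ-empty L) λ x j (ψ , γ̸) →
     γ̸ (boolean⇒core⊆canonical L cg-injective (boolean x) ψ))
  where
  open Equivalence
  cg-injective : CgInjective L
  cg-injective = congruenceUniform⇒cgInjective L cu
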